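{- Let $k\ge r\ge3$, $p,t\ge0$, and let $\pi\in\mathbb{C}_{<}(k,r|p,t)$ satisfy $\pi^{(2)}_{p}\geq 2t+6$. Then every part of $\pi$ equal to $2t+2$ or to $2t+4$ has mark at most $1$ in $GG(\pi)$.
   Context: A partition is a finite non-increasing sequence of positive integers. $\mathbb{C}(k,r)$ is the set of partitions $\pi=(\pi_1,\dots,\pi_\ell)$ with no repeated odd part, $\pi_i\ge\pi_{i+k-1}+2$ for $1\le i\le\ell-k+1$ (strict if $\pi_i$ even), and at most $r-1$ parts $\le2$. Göllnitz–Gordon marking $GG(\pi)$: marks (positive integers) are assigned to the parts from smallest to largest, each as small as possible subject to: the mark of $\pi_i$ differs from the marks of all parts $\pi_g$, $g>i$, with $\pi_i-\pi_g\le2$ (strict if $\pi_i$ odd). A "$j$-marked $x$" is a part $x$ with mark $j$. $N_j$ is the number of $j$-marked parts and $\pi^{(j)}_1>\cdots>\pi^{(j)}_{N_j}$ are these parts; $\pi^{(j)}_0=+\infty$, $\pi^{(j)}_{N_j+1}=-\infty$. Starting types (for $N_2\ge1$): let $l$ be the largest integer $0\le l\le N_2$ such that no odd part of $\pi$ is $\ge\pi^{(2)}_l$; parts $\pi^{(2)}_i$, $i>l$, are of type $s_{ -1}$. For $b=1$: $\pi^{(2)}_1$ is of type $s_0$ [resp. $s_1$] with $s_1(\pi)=\pi^{(2)}_1-1$ [resp. $-2$] if there is a 1-marked $\pi^{(2)}_1-1$ [resp. $\pi^{(2)}_1-2$] and $\pi^{(2)}_1+2$ does not occur; of type $s_2$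 ($s_1(\pi)=\pi^{(2)}_1+2$) if there is a 1-marked $\pi^{(2)}_1+2$; of type $s_3$ ($s_1(\pi)=\pi^{(2)}_1$) if there is a 1-marked $\pi^{(2)}_1$. For $b=2,\dots,l$: type $s_0$ [resp. $s_1$], $s_b(\pi)=\pi^{(2)}_b-1$ [resp. $-2$], if there is a 1-marked $\pi^{(2)}_b-1$ [resp. $-2$] and, whenever a 1-marked $\pi^{(2)}_b+2$ exists, $s_{b-1}(\pi)=\pi^{(2)}_b+2$; type $s_2$ ($s_b(\pi)=\pi^{(2)}_b+2$) if there is a 1-marked $\pi^{(2)}_b+2$ and $s_{b-1}(\pi)\neq\pi^{(2)}_b+2$; type $s_3$ ($s_b(\pi)=\pi^{(2)}_b$) if there is a 1-marked $\pi^{(2)}_b$. $\mathbb{C}_{<}(k,r|p,t)$ is the set of $\pi\in\mathbb{C}(k,r)$ such that: (1) no odd part is $\ge2t+1$; (2) $\pi^{(2)}_{p+1}<2t+1<\pi^{(2)}_p$; (3) if $\pi^{(2)}_p=2t+2$ it is of starting type $s_2$ or $s_3$; (4) if $\pi^{(2)}_{p+1}=2t$ it is of starting type $s_0$ or $s_1$. -}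

module Defs where

open import Data.Nat using (ℕ; zero; suc; _+_; _*_; _∸_; _≤_; _<_; _≡ᵇ_; _≤ᵇ_; _<ᵇ_)
open import Data.Nat.Divisibility using (_∣_; _∣?_)
open import Data.Bool using (Bool; true; false; if_then_else_; T?)
open import Data.List using (List; []; _∷_; map; filter; length; drop; head)
open import Data.Bool.ListAction using (any)
open import Data.List.Membership.Propositional using (_∈_)
open import Data.List.Relation.Unary.Linked using (Linked)
open import Data.List.Relation.Unary.All using (All)
open import Data.Fin using (Fin; toℕ)
open import Data.Maybe using (Maybe; just; nothing)
open import Data.Product using (Σ; _×_; _,_; proj₁; proj₂)
open import Data.Sum using (_⊎_)
open import Data.Empty using (⊥)
open import Data.Unit using (⊤)
open import Relation.Nullary using (¬_; does)
open import Relation.Binary.PropositionalEquality using (_≡_; _≢_)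

Even : ℕ → Set
Even n = 2 ∣ n

Odd : ℕ → Set
Odd n = ¬ Even n

-- A partition is a list of positive integers, non-increasing.
-- Index i (0-based in Agda) corresponds to π_{i+1}.

lookupL : (π : List ℕ) → Fin (length π) → ℕ
lookupL (x ∷ xs) Fin.zero = x
lookupL (x ∷ xs) (Fin.suc i) = lookupL xs i

IsPartition : List ℕ → Set
IsPartition π = All (λ x → 0 < x) π × Linked (λ a b → b ≤ a) π

InC : ℕ → ℕ → List ℕ → Set
InC k r π =
  IsPartition π
  × (∀ (i j : Fin (length π)) → toℕ i < toℕ j →
       lookupL π i ≡ lookupL π j → Even (lookupL π i))
  × (∀ (i j : Fin (length π)) → toℕ j ≡ toℕ i + (k ∸ 1) →
       (Even (lookupL π i) → lookupL π j + 2 < lookupL π i)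
       × (Odd (lookupL π i) → lookupL π j + 2 ≤ lookupL π i))
  × length (filter (λ x → x Data.Nat.≤? 2) π) ≤ r ∸ 1

-- Göllnitz–Gordon marking.
-- conflictᵇ x y : y (a later, hence not larger, part) conflicts with x
-- iff x - y ≤ 2, strictly if x odd.

conflictᵇ : ℕ → ℕ → Bool
conflictᵇ x y = if does (2 ∣? x) then (x ∸ y ≤ᵇ 2) else (x ∸ y <ᵇ 2)

elemᵇ : ℕ → List ℕ → Bool
elemᵇ n L = any (λ m → n ≡ᵇ m) L

searchFree : ℕ → ℕ → List ℕ → ℕ
searchFree zero c L = c
searchFree (suc f) c L = if elemᵇ c L then searchFree f (suc c) L else c

-- least positive integer not in L (the answer is ≤ length L + 1)
mex : List ℕ → ℕ
mex L = searchFree (length L) 1 L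

GG : List ℕ → List (ℕ × ℕ)
GG [] = []
GG (x ∷ xs) =
  (x , mex (map proj₂ (filter (λ q → T? (conflictᵇ x (proj₁ q))) (GG xs)))) ∷ GG xs

markedParts : ℕ → List ℕ → List ℕ
markedParts j π = map proj₁ (filter (λ q → proj₂ q Data.Nat.≟ j) (GG π))

N : ℕ → List ℕ → ℕ
N j π = length (markedParts j π)

IsMarked : List ℕ → ℕ → ℕ → Set
IsMarked π j y = (y , j) ∈ GG π

data ℕ∞ : Set where
  -∞ : ℕ∞
  fin : ℕ → ℕ∞
  +∞ : ℕ∞

_<ₑ_ : ℕ∞ → ℕ∞ → Set
-∞ <ₑ -∞ = ⊥
-∞ <ₑ fin _ = ⊤
-∞ <ₑ +∞ = ⊤
fin a <ₑ -∞ = ⊥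
fin a <ₑ fin b = a < b
fin a <ₑ +∞ = ⊤
+∞ <ₑ _ = ⊥

_≤ₑ_ : ℕ∞ → ℕ∞ → Set
-∞ ≤ₑ _ = ⊤
fin a ≤ₑ -∞ = ⊥
fin a ≤ₑ fin b = a ≤ b
fin a ≤ₑ +∞ = ⊤
+∞ ≤ₑ +∞ = ⊤
+∞ ≤ₑ _ = ⊥

-- π^{(2)}_b with π^{(2)}_0 = +∞ and π^{(2)}_b = -∞ for b > N_2
pi2 : List ℕ → ℕ → ℕ∞
pi2 π zero = +∞
pi2 π (suc b) with head (drop b (markedParts 2 π))
... | just x = fin x
... | nothing = -∞

NoOddAbove : List ℕ → ℕ → Set
NoOddAbove π l = ∀ y → y ∈ π → Odd y → fin y <ₑ pi2 π l

IsL : List ℕ → ℕ → Set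
IsL π l = l ≤ N 2 π × NoOddAbove π l
        × (∀ l' → l < l' → l' ≤ N 2 π → ¬ NoOddAbove π l')

data SType : Set where
  s-1 s0 s1 s2 s3 : SType

-- the value s_b(π) associated to type s, where x = π^{(2)}_b
sval : SType → ℕ → ℕ
sval s-1 x = x
sval s0 x = x ∸ 1
sval s1 x = x ∸ 2
sval s2 x = x + 2
sval s3 x = x

mutual
  HasType : List ℕ → ℕ → SType → Set
  HasType π b s-1 = Σ ℕ λ l → IsL π l × l < b × b ≤ N 2 π
  HasType π zero _ = ⊥
  HasType π (suc b) s =
    Σ ℕ λ x → pi2 π (suc b) ≡ fin x
      × (Σ ℕ λ l → IsL π l × suc b ≤ l)
      × Cond π b s x

  Cond : List ℕ → ℕ → SType → ℕ → Set
  Cond π _ s-1 x = ⊥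
  Cond π zero s0 x = IsMarked π 1 (x ∸ 1) × ¬ ((x + 2) ∈ π)
  Cond π zero s1 x = IsMarked π 1 (x ∸ 2) × ¬ ((x + 2) ∈ π)
  Cond π zero s2 x = IsMarked π 1 (x + 2)
  Cond π zero s3 x = IsMarked π 1 x
  Cond π (suc b) s0 x =
    IsMarked π 1 (x ∸ 1) × (IsMarked π 1 (x + 2) → SValIs π (suc b) (x + 2))
  Cond π (suc b) s1 x =
    IsMarked π 1 (x ∸ 2) × (IsMarked π 1 (x + 2) → SValIs π (suc b) (x + 2))
  Cond π (suc b) s2 x = IsMarked π 1 (x + 2) × ¬ SValIs π (suc b) (x + 2)
  Cond π (suc b) s3 x = IsMarked π 1 x

  SValIs : List ℕ → ℕ → ℕ → Set
  SValIs π b v =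
    Σ SType λ s → s ≢ s-1 × HasType π b s
      × (Σ ℕ λ x → pi2 π b ≡ fin x × v ≡ sval s x)

InC< : ℕ → ℕ → ℕ → ℕ → List ℕ → Set
InC< k r p t π =
  InC k r π
  × (∀ y → y ∈ π → Odd y → y < 2 * t + 1)
  × pi2 π (suc p) <ₑ fin (2 * t + 1)
  × fin (2 * t + 1) <ₑ pi2 π p
  × (pi2 π p ≡ fin (2 * t + 2) → HasType π p s2 ⊎ HasType π p s3)
  × (pi2 π (suc p) ≡ fin (2 * t) → HasType π (suc p) s0 ⊎ HasType π (suc p) s1)

-- Write a = 2t. A part carrying mark j has, for every 1 ≤ i < j, an i-marked part at most 2
-- below it. Since π⁽²⁾ₚ ≥ a + 6 and π⁽²⁾ₚ₊₁ ≤ a, no 2-marked part lies in [a + 1, a + 5], so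
-- neither a + 2 nor a + 4 is 2-marked, and a mark ≥ 3 on one of them needs a 2-marked part
-- within 2 below it: this forces the part a + 2 and π⁽²⁾ₚ₊₁ = a, which then has starting type
-- s₀ or s₁. The 1-marked part within 2 below a + 2 is a or a + 2 (no odd part exceeds a), and
-- both are excluded: a would conflict with the 1-marked a − 1 or a − 2, while a + 2 is absent
-- when p = 0 and otherwise would give s_p(π) = a + 2 < π⁽²⁾ₚ − 2.
-- Only the partition structure of C(k,r) is used.

module Submission where

open import Defs
open import Data.Nat using (ℕ; zero; suc; _+_; _*_; _∸_; _≤_; _<_; _≰_; _<ᵇ_; z≤n; s≤s; z<s)
open import Data.Nat.Properties
open import Data.Nat.Divisibility using (_∣?_; ∣1⇒≡1; ∣m+n∣m⇒∣n; m∣m*n)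
open import Data.List using (List; []; _∷_; map; length; drop)
open import Data.List.Relation.Unary.Linked as Linked using (Linked; [-]; _∷_)
open import Data.List.Relation.Unary.Linked.Properties using (Linked⇒AllPairs; map⁺; map⁻; filter⁺)
open import Data.List.Relation.Unary.AllPairs using (_∷_)
open import Data.List.Relation.Unary.All as All using (All)
open import Data.List.Relation.Unary.Any as Any using (here; there)
open import Data.List.Relation.Unary.Any.Properties using (any⁺; any⁻)
open import Data.List.Membership.Propositional using (_∈_)
open import Data.List.Membership.Propositional.Properties using (∈-map⁺; ∈-map⁻; ∈-filter⁺; ∈-filter⁻)
open import Data.Product using (Σ; _×_; _,_; proj₁; proj₂; uncurry)
open import Data.Sum as Sum using (_⊎_; inj₁; inj₂; [_,_]′)
open import Data.Empty using (⊥; ⊥-elim)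
open import Data.Unit using (tt)
open import Data.Bool using (true; false; T; T?)
open import Relation.Nullary using (¬_; does; yes; no; contradiction)
open import Relation.Nullary.Decidable using (dec-true)
open import Relation.Binary.PropositionalEquality using (_≡_; _≢_; refl; sym; trans; cong; subst)

m≤m∸n+n : ∀ m n → m ≤ m ∸ n + n
m≤m∸n+n m n = subst (m ≤_) (+-comm n (m ∸ n)) (m≤n+m∸n m n)

m∸n≤o⇒m≤n+o : ∀ {m n o} → m ∸ n ≤ o → m ≤ n + o
m∸n≤o⇒m≤n+o {m} {n} h = ≤-trans (m≤n+m∸n m n) (+-monoʳ-≤ n h)

m∸n<m : ∀ {m n} → 0 < m → 0 < n → m ∸ n < m
m∸n<m {suc m} {suc n} _ _ = s≤s (m∸n≤m m n)

m<n+1⇒m≤n : ∀ {m n} → m < n + 1 → m ≤ n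
m<n+1⇒m≤n {m} {n} h = ≤-pred (subst (m <_) (+-comm n 1) h)

-- Comparisons between small literals are discharged by evaluating _<ᵇ_.
a+m≰a+n : ∀ a {m n} → T (n <ᵇ m) → a + m ≰ a + n
a+m≰a+n a {m} {n} n<m = <⇒≱ (+-monoʳ-< a (<ᵇ⇒< n m n<m))

a+2⊎a+4⇒bounded : ∀ a {y} → y ≡ a + 2 ⊎ y ≡ a + 4 → a + 2 ≤ y × y ≤ a + 4
a+2⊎a+4⇒bounded a (inj₁ refl) = ≤-refl , +-monoʳ-≤ a (s≤s (s≤s z≤n))
a+2⊎a+4⇒bounded a (inj₂ refl) = +-monoʳ-≤ a (s≤s (s≤s z≤n)) , ≤-refl

between-a-and-a+2 : ∀ a {w} → a ≤ w → w ≤ a + 2 → w ≡ a ⊎ w ≡ a + 1 ⊎ w ≡ a + 2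
between-a-and-a+2 zero {0} _ _ = inj₁ refl
between-a-and-a+2 zero {1} _ _ = inj₂ (inj₁ refl)
between-a-and-a+2 zero {2} _ _ = inj₂ (inj₂ refl)
between-a-and-a+2 zero {suc (suc (suc _))} _ (s≤s (s≤s ()))
between-a-and-a+2 (suc a) (s≤s a≤w) (s≤s w≤a+2) =
  Sum.map (cong suc) (Sum.map (cong suc) (cong suc)) (between-a-and-a+2 a a≤w w≤a+2)

even⇒odd-+1 : ∀ {a} → Even a → Odd (a + 1)
even⇒odd-+1 2∣a 2∣a+1 with ∣1⇒≡1 (∣m+n∣m⇒∣n 2∣a+1 2∣a)
... | ()

≤ₑ-+∞ : ∀ e → e ≤ₑ +∞
≤ₑ-+∞ -∞ = tt
≤ₑ-+∞ (fin _) = tt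
≤ₑ-+∞ +∞ = tt

≤ₑ-refl : ∀ {e} → e ≤ₑ e
≤ₑ-refl { -∞} = tt
≤ₑ-refl {fin x} = ≤-refl
≤ₑ-refl {+∞} = tt

≤ₑ-trans : ∀ {d e f} → d ≤ₑ e → e ≤ₑ f → d ≤ₑ f
≤ₑ-trans { -∞} _ _ = tt
≤ₑ-trans {fin _} {fin _} {fin _} p q = ≤-trans p q
≤ₑ-trans {fin _} {_} {+∞} _ _ = tt
≤ₑ-trans {fin _} {fin _} { -∞} _ ()
≤ₑ-trans {fin _} {+∞} { -∞} _ ()
≤ₑ-trans {fin _} {+∞} {fin _} _ ()
≤ₑ-trans {+∞} {+∞} {+∞} _ _ = tt

fin-injective : ∀ {x y} → fin x ≡ fin y → x ≡ y
fin-injective refl = refl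

fin-between : ∀ {z c} e → fin z ≤ₑ e → e <ₑ fin (c + 1) → Σ ℕ λ w → e ≡ fin w × z ≤ w × w ≤ c
fin-between (fin w) z≤w w<c+1 = w , refl , z≤w , m<n+1⇒m≤n w<c+1

elemᵇ⇒∈ : ∀ {n} L → T (elemᵇ n L) → n ∈ L
elemᵇ⇒∈ {n} L h = Any.map (λ {m} → ≡ᵇ⇒≡ n m) (any⁻ _ L h)

∈⇒elemᵇ : ∀ {n L} → n ∈ L → T (elemᵇ n L)
∈⇒elemᵇ {n} n∈L = any⁺ _ (Any.map (λ { refl → ≡⇒≡ᵇ n n refl }) n∈L)

searchFree-≥ : ∀ f c L → c ≤ searchFree f c L
searchFree-≥ zero c L = ≤-refl
searchFree-≥ (suc f) c L with elemᵇ c L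
... | true = ≤-trans (n≤1+n c) (searchFree-≥ f (suc c) L)
... | false = ≤-refl

searchFree-minimal : ∀ f c L {i} → c ≤ i → i < searchFree f c L → i ∈ L
searchFree-minimal zero c L c≤i i<c = contradiction c≤i (<⇒≱ i<c)
searchFree-minimal (suc f) c L c≤i i<s with elemᵇ c L in c∈L | m≤n⇒m<n∨m≡n c≤i
... | false | _ = contradiction c≤i (<⇒≱ i<s)
... | true | inj₁ c<i = searchFree-minimal f (suc c) L c<i i<s
... | true | inj₂ refl = elemᵇ⇒∈ L (subst T (sym c∈L) tt)

searchFree-skips : ∀ f {c L} → c ∈ L → c < searchFree (suc f) c L
searchFree-skips f {c} {L} c∈L with elemᵇ c L | ∈⇒elemᵇ c∈L
... | true | _ = searchFree-≥ f (suc c) L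

mex-minimal : ∀ L {i} → 1 ≤ i → i < mex L → i ∈ L
mex-minimal L = searchFree-minimal (length L) 1 L

1∈⇒mex≢1 : ∀ {L} → 1 ∈ L → mex L ≢ 1
1∈⇒mex≢1 {_ ∷ L} 1∈L mex≡1 = <-irrefl (sym mex≡1) (searchFree-skips (length L) 1∈L)

NonIncreasing : List ℕ → Set
NonIncreasing = Linked (λ a b → b ≤ a)

nonIncreasing-head-≥ : ∀ {x z xs} → NonIncreasing (x ∷ xs) → z ∈ xs → z ≤ x
nonIncreasing-head-≥ s z∈xs with Linked⇒AllPairs (λ r₁ r₂ → ≤-trans r₂ r₁) s
... | x≥xs ∷ _ = All.lookup x≥xs z∈xs

GG-parts : ∀ π → map proj₁ (GG π) ≡ π
GG-parts [] = refl
GG-parts (x ∷ π) = cong (x ∷_) (GG-parts π)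

GG-part : ∀ π {z m} → (z , m) ∈ GG π → z ∈ π
GG-part π mem = subst (_ ∈_) (GG-parts π) (∈-map⁺ proj₁ mem)

markedParts-nonIncreasing : ∀ {π} j → NonIncreasing π → NonIncreasing (markedParts j π)
markedParts-nonIncreasing {π} j s =
  map⁺ (filter⁺ (λ q → proj₂ q ≟ j) (λ r₁ r₂ → ≤-trans r₂ r₁)
    (map⁻ (subst NonIncreasing (sym (GG-parts π)) s)))

conflictᵇ⇒≤+2 : ∀ x z → T (conflictᵇ x z) → x ≤ z + 2
conflictᵇ⇒≤+2 x z c with does (2 ∣? x)
... | true = m∸n≤o⇒m≤n+o (≤ᵇ⇒≤ (x ∸ z) 2 c)
... | false = m∸n≤o⇒m≤n+o (<⇒≤ (<ᵇ⇒< (x ∸ z) 2 c))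

even⇒conflictᵇ : ∀ {x z} → Even x → x ≤ z + 2 → T (conflictᵇ x z)
even⇒conflictᵇ {x} {z} 2∣x h rewrite dec-true (2 ∣? x) 2∣x = ≤⇒≤ᵇ (m≤n+o⇒m∸n≤o x z h)

GG-lower-marks : ∀ {π y j i} → NonIncreasing π → (y , j) ∈ GG π → 1 ≤ i → i < j →
  Σ ℕ λ z → (z , i) ∈ GG π × z ≤ y × y ≤ z + 2
GG-lower-marks {x ∷ π} s (here refl) 1≤i i<j with ∈-map⁻ proj₂ (mex-minimal _ 1≤i i<j)
... | (z , _) , mem , refl with ∈-filter⁻ (λ q → T? (conflictᵇ x (proj₁ q))) mem
... | z-mem , c = z , there z-mem , nonIncreasing-head-≥ s (GG-part π z-mem) , conflictᵇ⇒≤+2 x z c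
GG-lower-marks {x ∷ π} s (there mem) 1≤i i<j with GG-lower-marks (Linked.tail s) mem 1≤i i<j
... | z , z-mem , z≤y , y≤z+2 = z , there z-mem , z≤y , y≤z+2

1-marked-conflict-free : ∀ {π x z} → NonIncreasing π → (x , 1) ∈ GG π → (z , 1) ∈ GG π → z < x →
  ¬ T (conflictᵇ x z)
1-marked-conflict-free {_ ∷ _} _ (here x≡) (here z≡) z<x _ =
  <-irrefl (trans (cong proj₁ z≡) (sym (cong proj₁ x≡))) z<x
1-marked-conflict-free {x ∷ π} s (here x≡) (there z-mem) z<x c with cong proj₁ x≡
... | refl = 1∈⇒mex≢1 (∈-map⁺ proj₂ (∈-filter⁺ (λ q → T? (conflictᵇ x (proj₁ q))) z-mem c))
                      (sym (cong proj₂ x≡))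
1-marked-conflict-free {_ ∷ π} s (there x-mem) (here z≡) z<x _ with cong proj₁ z≡
... | refl = <⇒≱ z<x (nonIncreasing-head-≥ s (GG-part π x-mem))
1-marked-conflict-free {_ ∷ _} s (there x-mem) (there z-mem) =
  1-marked-conflict-free (Linked.tail s) x-mem z-mem

headₑ : List ℕ → ℕ∞
headₑ [] = -∞
headₑ (x ∷ _) = fin x

pi2-suc : ∀ π b → pi2 π (suc b) ≡ headₑ (drop b (markedParts 2 π))
pi2-suc π b with drop b (markedParts 2 π)
... | [] = refl
... | _ ∷ _ = refl

headₑ-tail-≤ : ∀ {x xs} → NonIncreasing (x ∷ xs) → headₑ xs ≤ₑ fin x
headₑ-tail-≤ [-] = tt
headₑ-tail-≤ (x≥y ∷ _) = x≥y

headₑ-drop-antitone : ∀ {xs m n} → NonIncreasing xs → m ≤ n →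
  headₑ (drop n xs) ≤ₑ headₑ (drop m xs)
headₑ-drop-antitone {_} {zero} {zero} _ _ = ≤ₑ-refl
headₑ-drop-antitone {[]} {zero} {suc _} _ _ = tt
headₑ-drop-antitone {_ ∷ _} {zero} {suc n} s _ =
  ≤ₑ-trans (headₑ-drop-antitone {n = n} (Linked.tail s) z≤n) (headₑ-tail-≤ s)
headₑ-drop-antitone {[]} {suc _} {suc _} _ _ = tt
headₑ-drop-antitone {_ ∷ _} {suc _} {suc _} s (s≤s m≤n) = headₑ-drop-antitone (Linked.tail s) m≤n

pi2-antitone : ∀ {π m n} → NonIncreasing π → m ≤ n → pi2 π n ≤ₑ pi2 π m
pi2-antitone {π} {zero} {n} _ _ = ≤ₑ-+∞ (pi2 π n)
pi2-antitone {π} {suc m} {suc n} s (s≤s m≤n) rewrite pi2-suc π m | pi2-suc π n =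
  headₑ-drop-antitone (markedParts-nonIncreasing 2 s) m≤n

∈⇒headₑ-drop : ∀ {z xs} → z ∈ xs → Σ ℕ λ i → headₑ (drop i xs) ≡ fin z
∈⇒headₑ-drop (here refl) = 0 , refl
∈⇒headₑ-drop (there z∈xs) with ∈⇒headₑ-drop z∈xs
... | i , eq = suc i , eq

2-marked⇒pi2 : ∀ {π z} → (z , 2) ∈ GG π → Σ ℕ λ i → pi2 π (suc i) ≡ fin z
2-marked⇒pi2 {π} mem with ∈⇒headₑ-drop (∈-map⁺ proj₁ (∈-filter⁺ (λ q → proj₂ q ≟ 2) mem refl))
... | i , eq = i , trans (pi2-suc π i) eq

2-marked-straddles : ∀ {π z} → NonIncreasing π → (z , 2) ∈ GG π →
  ∀ p → fin z ≤ₑ pi2 π (suc p) ⊎ pi2 π p ≤ₑ fin z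
2-marked-straddles {π} s mem p with 2-marked⇒pi2 mem
... | i , pi≡z with p ≤? i
... | yes p≤i = inj₁ (subst (_≤ₑ pi2 π (suc p)) pi≡z (pi2-antitone s (s≤s p≤i)))
... | no p≰i = inj₂ (subst (pi2 π p ≤ₑ_) pi≡z (pi2-antitone s (≰⇒> p≰i)))

sval-+2 : ∀ s x → x ≤ sval s x + 2
sval-+2 s-1 x = m≤m+n x 2
sval-+2 s0 x = ≤-trans (m≤m∸n+n x 1) (+-monoʳ-≤ (x ∸ 1) (s≤s z≤n))
sval-+2 s1 x = m≤m∸n+n x 2
sval-+2 s2 x = ≤-trans (m≤m+n x 2) (m≤m+n (x + 2) 2)
sval-+2 s3 x = m≤m+n x 2

SValIs-≤ : ∀ {π b v} → SValIs π b v → pi2 π b ≤ₑ fin (v + 2)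
SValIs-≤ (s , _ , _ , x , pi≡x , refl) = subst (_≤ₑ fin (sval s x + 2)) (sym pi≡x) (sval-+2 s x)

lowType⇒Cond : ∀ {π b x} → HasType π (suc b) s0 ⊎ HasType π (suc b) s1 → pi2 π (suc b) ≡ fin x →
  Cond π b s0 x ⊎ Cond π b s1 x
lowType⇒Cond (inj₁ (y , pi≡y , _ , c)) pi≡x with fin-injective (trans (sym pi≡y) pi≡x)
... | refl = inj₁ c
lowType⇒Cond (inj₂ (y , pi≡y , _ , c)) pi≡x with fin-injective (trans (sym pi≡y) pi≡x)
... | refl = inj₂ c

lowCond-1-marked-below : ∀ {π x} b → Cond π b s0 x ⊎ Cond π b s1 x →
  IsMarked π 1 (x ∸ 1) ⊎ IsMarked π 1 (x ∸ 2)
lowCond-1-marked-below zero = Sum.map proj₁ proj₁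
lowCond-1-marked-below (suc _) = Sum.map proj₁ proj₁

lowCond-no-1-marked-above : ∀ {π x} b → fin (x + 6) ≤ₑ pi2 π b → Cond π b s0 x ⊎ Cond π b s1 x →
  ¬ IsMarked π 1 (x + 2)
lowCond-no-1-marked-above {π} zero _ c mem = [ proj₂ , proj₂ ]′ c (GG-part π mem)
lowCond-no-1-marked-above {x = x} (suc b) above c mem =
  a+m≰a+n x _ (≤-trans (≤ₑ-trans above (SValIs-≤ ([ proj₂ , proj₂ ]′ c mem)))
                       (≤-reflexive (+-assoc x 2 2)))

module _ {π : List ℕ} {a p : ℕ} (sorted : NonIncreasing π) (positive : All (0 <_) π)
         (a-even : Even a) (odd-below : ∀ x → x ∈ π → Odd x → x < a + 1)
         (below : pi2 π (suc p) <ₑ fin (a + 1)) (above : fin (a + 6) ≤ₑ pi2 π p)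
         (lowType : pi2 π (suc p) ≡ fin a → HasType π (suc p) s0 ⊎ HasType π (suc p) s1) where

  2-marked-outside-gap : ∀ {z} → (z , 2) ∈ GG π →
    (Σ ℕ λ w → pi2 π (suc p) ≡ fin w × z ≤ w × w ≤ a) ⊎ a + 6 ≤ z
  2-marked-outside-gap mem with 2-marked-straddles sorted mem p
  ... | inj₁ z≤next = inj₁ (fin-between (pi2 π (suc p)) z≤next below)
  ... | inj₂ prev≤z = inj₂ (≤ₑ-trans above prev≤z)

  no-2-marked-in-gap : ∀ {y} → (y , 2) ∈ GG π → a + 2 ≤ y → y ≤ a + 4 → ⊥
  no-2-marked-in-gap mem a+2≤y y≤a+4 with 2-marked-outside-gap mem
  ... | inj₁ (_ , _ , y≤w , w≤a) = m+1+n≰m a (≤-trans a+2≤y (≤-trans y≤w w≤a))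
  ... | inj₂ a+6≤y = a+m≰a+n a _ (≤-trans a+6≤y y≤a+4)

  no-1-marked-near-lowType : 0 < a → pi2 π (suc p) ≡ fin a →
    ∀ {w} → (w , 1) ∈ GG π → a ≤ w → w ≤ a + 2 → ⊥
  no-1-marked-near-lowType 0<a next≡a {w} mem a≤w w≤a+2
    with lowType⇒Cond (lowType next≡a) next≡a | between-a-and-a+2 a a≤w w≤a+2
  ... | c | inj₁ refl =
    [ conflicts 1 z<s (s≤s z≤n) , conflicts 2 z<s (s≤s (s≤s z≤n)) ]′ (lowCond-1-marked-below p c)
    where
      conflicts : ∀ k → 0 < k → k ≤ 2 → ¬ IsMarked π 1 (a ∸ k)
      conflicts k 0<k k≤2 below-mem =
        1-marked-conflict-free sorted mem below-mem (m∸n<m 0<a 0<k)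
          (even⇒conflictᵇ a-even (≤-trans (m≤m∸n+n a k) (+-monoʳ-≤ (a ∸ k) k≤2)))
  ... | _ | inj₂ (inj₁ refl) = <-irrefl refl (odd-below (a + 1) (GG-part π mem) (even⇒odd-+1 a-even))
  ... | c | inj₂ (inj₂ refl) = lowCond-no-1-marked-above p above c mem

  no-high-mark-in-gap : ∀ {y j} → (y , j) ∈ GG π → a + 2 ≤ y → y ≤ a + 4 → 2 < j → ⊥
  no-high-mark-in-gap {y} mem a+2≤y y≤a+4 2<j with GG-lower-marks sorted mem (s≤s z≤n) 2<j
  ... | z , z-mem , z≤y , y≤z+2 with 2-marked-outside-gap z-mem
  ... | inj₂ a+6≤z = a+m≰a+n a _ (≤-trans a+6≤z (≤-trans z≤y y≤a+4))
  ... | inj₁ (w , next≡w , z≤w , w≤a) with GG-lower-marks sorted mem ≤-refl (<⇒≤ 2<j)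
  ... | u , u-mem , u≤y , y≤u+2 =
    no-1-marked-near-lowType 0<a next≡a u-mem
      (+-cancelʳ-≤ 2 a u (≤-trans a+2≤y y≤u+2)) (≤-trans u≤y y≤a+2)
    where
      z≤a : z ≤ a
      z≤a = ≤-trans z≤w w≤a
      a≤z : a ≤ z
      a≤z = +-cancelʳ-≤ 2 a z (≤-trans a+2≤y y≤z+2)
      next≡a : pi2 π (suc p) ≡ fin a
      next≡a = trans next≡w (cong fin (≤-antisym w≤a (≤-trans a≤z z≤w)))
      y≤a+2 : y ≤ a + 2
      y≤a+2 = ≤-trans y≤z+2 (+-monoˡ-≤ 2 z≤a)
      0<a : 0 < a
      0<a = ≤-trans (All.lookup positive (GG-part π z-mem)) z≤a

  marks-in-gap-≤1 : ∀ {y j} → (y , j) ∈ GG π → y ≡ a + 2 ⊎ y ≡ a + 4 → j ≤ 1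
  marks-in-gap-≤1 {j = 0} _ _ = z≤n
  marks-in-gap-≤1 {j = 1} _ _ = s≤s z≤n
  marks-in-gap-≤1 {j = 2} mem y≡ =
    ⊥-elim (uncurry (no-2-marked-in-gap mem) (a+2⊎a+4⇒bounded a y≡))
  marks-in-gap-≤1 {j = suc (suc (suc _))} mem y≡ =
    ⊥-elim (uncurry (no-high-mark-in-gap mem) (a+2⊎a+4⇒bounded a y≡) (s≤s (s≤s (s≤s z≤n))))

lemma2p4 : (k r p t : ℕ) → 3 ≤ r → r ≤ k → (π : List ℕ) →
    InC< k r p t π → fin (2 * t + 6) ≤ₑ pi2 π p →
    ∀ (y j : ℕ) → (y , j) ∈ GG π → (y ≡ 2 * t + 2 ⊎ y ≡ 2 * t + 4) → j ≤ 1
lemma2p4 k r p t _ _ π (((positive , sorted) , _) , odd-below , below , _ , _ , lowType)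
         above y j mem y≡ =
  marks-in-gap-≤1 sorted positive (m∣m*n t) odd-below below above lowType mem y≡
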